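{- The transition graph $Tr_n$ is invariant under the cyclic shift $w\mapsto ow$: for all $u,w\in S_n$, $u\to w$ is an edge of $Tr_n$ if and only if $ou\to ow$ is an edge of $Tr_n$.
   Context: $\ell(w)$ is the number of inversions of $w\in S_n$; $s_{ab}$ is the transposition exchanging $a<b$; products of permutations are compositions. The transition graph $Tr_n$ is the directed graph on vertex set $S_n$ with an edge $u\to w$ whenever $w=us_{ab}$ for some $1\le a<b\le n$ and either $\ell(w)=\ell(u)+1$ or $\ell(w)=\ell(u)-\ell(s_{ab})$ (where $\ell(s_{ab})=2(b-a)-1$). The permutation $o\in S_n$ is the cycle $o(i)=i+1$ for $i<n$, $o(n)=1$. -}

module Defs where

open import Data.Nat using (ℕ; zero; suc; _+_; _*_; _∸_)
open import Data.Fin using (Fin; zero; suc; _<_; toℕ; inject₁; fromℕ; lower₁)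
open import Data.Fin.Properties using (_<?_; _≟_)
open import Data.Fin.Permutation using (Permutation′; _⟨$⟩ʳ_; transpose)
open import Data.List using (List; length; filter; cartesianProduct)
open import Data.List using () renaming (allFin to allFinL)
open import Data.Product using (_×_; _,_; proj₁; proj₂; ∃; ∃-syntax)
open import Data.Sum using (_⊎_)
open import Relation.Nullary using (Dec; yes; no; ¬_)
open import Relation.Nullary.Decidable using (_×-dec_)
open import Relation.Binary.PropositionalEquality using (_≡_; refl; cong)
open import Data.Fin.Permutation using (permutation; _∘ₚ_)

invF : {n : ℕ} → (Fin n → Fin n) → ℕ
invF {n} w = length (filter (λ p → (proj₁ p <? proj₂ p) ×-dec (w (proj₂ p) <? w (proj₁ p)))
                            (cartesianProduct (allFinL n) (allFinL n)))

ℓ : {n : ℕ} → Permutation′ n → ℕ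
ℓ w = invF (w ⟨$⟩ʳ_)

s : {n : ℕ} → Fin n → Fin n → Permutation′ n
s a b = transpose a b

-- Products are compositions: (u s_ab)(i) = u (s_ab (i)); permutations are compared pointwise.
-- The subtraction is stated additively: ℓ(w) + ℓ(s_ab) = ℓ(u).
Edge : {n : ℕ} → Permutation′ n → Permutation′ n → Set
Edge u w = ∃[ a ] ∃[ b ] (a < b ×
             ((∀ i → w ⟨$⟩ʳ i ≡ u ⟨$⟩ʳ (s a b ⟨$⟩ʳ i)) ×
              (ℓ w ≡ suc (ℓ u) ⊎ ℓ w + ℓ (s a b) ≡ ℓ u)))


-- the cycle o(i) = i+1 (i < n), o(n) = 1, written 0-indexed on Fin (suc m)
-- the cycle o(i) = i+1 (i < n), o(n) = 1, written 0-indexed on Fin (suc m)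
oF : {m : ℕ} → Fin (suc m) → Fin (suc m)
oF {zero} zero = zero
oF {suc m} zero = suc zero
oF {suc m} (suc i) with oF {m} i
... | zero = zero
... | suc k = suc (suc k)

oI : {m : ℕ} → Fin (suc m) → Fin (suc m)
oI {m} zero = fromℕ m
oI {suc m} (suc j) = inject₁ j

oI-oF : {m : ℕ} (i : Fin (suc m)) → oI (oF i) ≡ i
oI-oF {zero} zero = refl
oI-oF {suc m} zero = refl
oI-oF {suc zero} (suc zero) = refl
oI-oF {suc (suc m)} (suc i) with oF {suc m} i | oI-oF {suc m} i
... | zero | eq = cong suc eq
... | suc k | eq = cong suc eq

oF-fromℕ : (m : ℕ) → oF (fromℕ m) ≡ zero
oF-fromℕ zero = refl
oF-fromℕ (suc m) rewrite oF-fromℕ m = refl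

oF-inject : {m : ℕ} (j : Fin (suc m)) → oF {suc m} (inject₁ j) ≡ suc j
oF-inject {m} zero = refl
oF-inject {suc m} (suc j) rewrite oF-inject {m} j = refl

oF-oI : {m : ℕ} (i : Fin (suc m)) → oF (oI i) ≡ i
oF-oI {m} zero = oF-fromℕ m
oF-oI {suc m} (suc j) = oF-inject j

o : {n : ℕ} → Permutation′ n
o {zero} = permutation (λ ()) (λ ()) (λ ()) (λ ())
o {suc m} = permutation oF oI oF-oI oI-oF

-- the product o w (composition: (o w)(i) = o (w i)); in stdlib, π ∘ₚ ρ applies π first
o· : {n : ℕ} → Permutation′ n → Permutation′ n
o· w = w ∘ₚ o

-- Let p be the 0-based position of the largest value of u. Composing with o raises every value
-- by one except the maximum, which becomes 0, so only the inversions through p change: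
-- ℓ(ou) = ℓ(u) + 2p + 1 - n. Let w = u s_ab. If p ∉ {a, b}, the maximum of w also sits at p,
-- so ℓ(ow) - ℓ(ou) = ℓ(w) - ℓ(u) and the length condition carries over in both directions.
-- If p = b, the maximum of w sits at a and, as ℓ(s_ab) = 2(b - a) - 1,
-- ℓ(ow) - ℓ(ou) = ℓ(w) - ℓ(u) - ℓ(s_ab) - 1. Transposing an ascent increases the length, and
-- both u(a) < u(b) and ow(a) = 0 < ow(b) are ascents; so ℓ(w) = ℓ(u) + 1 and
-- ℓ(ow) = ℓ(ou) - ℓ(s_ab) are the only options on either side, and they are equivalent.
-- The case p = a is the mirror image.

module Submission where

open import Level using (Level)
open import Data.Bool using (true; false; if_then_else_)
open import Data.Empty using (⊥-elim)
open import Data.Nat as ℕ using (ℕ; zero; suc; _+_; _*_; z≤n; s≤s)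
import Data.Nat.Properties as ℕ
open import Data.Nat.Properties using (+-*-semiring; +-identityʳ; +-cancelʳ-≡)
open import Data.Nat.Tactic.RingSolver using (solve)
open import Data.Fin using (Fin; zero; suc; toℕ; _<_; fromℕ; inject₁; lower₁)
open import Data.Fin.Properties
  using ( _<?_; _≟_; <-cmp; <-irrefl; <-asym; <-trans; <⇒≢; ≤fromℕ
        ; toℕ-injective; toℕ-fromℕ; toℕ-lower₁; inject₁-lower₁ )
open import Data.Fin.Permutation using (Permutation′; _⟨$⟩ʳ_; _⟨$⟩ˡ_; inverseʳ)
import Data.Fin.Permutation.Components as PC
open import Data.List using (List; []; _∷_; _++_; length; filter; map; tabulate; cartesianProduct; allFin)
open import Data.List.Properties using (filter-++; length-++; map-tabulate)
open import Data.Product using (_×_; _,_)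
open import Data.Sum using (_⊎_; inj₁; inj₂)
open import Function using (id; _∘_)
open import Function.Bundles using (_⇔_; mk⇔; Equivalence; Injection)
open import Function.Properties.Inverse using (↔⇒↣)
open import Relation.Binary using (tri<; tri≈; tri>)
open import Relation.Binary.PropositionalEquality
  using (_≡_; _≢_; refl; sym; trans; cong; cong₂; subst; subst₂; module ≡-Reasoning)
open import Relation.Nullary using (Dec; does; yes; no; ¬_)
open import Relation.Nullary.Decidable using (dec-true; dec-false; _×-dec_)
open import Relation.Unary using (Pred; Decidable)
open import Algebra.Properties.Semiring.Sum +-*-semiring
  using (sum-syntax; ∑-distrib-+; *-distribˡ-sum; *-distribʳ-sum; sum-cong-≗; sum-replicate-zero)

open import Defs

open ≡-Reasoning

private variable
  ℓ₁ ℓ₂ : Level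
  A B : Set ℓ₁
  n : ℕ

indicator : {P : Set ℓ₁} → Dec P → ℕ
indicator P? = if does P? then 1 else 0

[_<_] [_≡_] : Fin n → Fin n → ℕ
[ i < j ] = indicator (i <? j)
[ i ≡ j ] = indicator (i ≟ j)

[<]-yes : {i j : Fin n} → i < j → [ i < j ] ≡ 1
[<]-yes {i = i} {j} i<j = cong (λ b → if b then 1 else 0) (dec-true (i <? j) i<j)

[<]-no : {i j : Fin n} → ¬ i < j → [ i < j ] ≡ 0
[<]-no {i = i} {j} i≮j = cong (λ b → if b then 1 else 0) (dec-false (i <? j) i≮j)

[<]-irrefl : (i : Fin n) → [ i < i ] ≡ 0
[<]-irrefl i = [<]-no {i = i} {i} (<-irrefl refl)

[<]*[>] : (i j : Fin n) → [ i < j ] * [ j < i ] ≡ 0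
[<]*[>] i j with <-cmp i j
... | tri< i<j _ _ rewrite [<]-yes i<j | [<]-no (<-asym i<j) = refl
... | tri≈ i≮j _ _ rewrite [<]-no i≮j = refl
... | tri> i≮j _ _ rewrite [<]-no i≮j = refl

indicator-×-dec : {P : Set ℓ₁} {Q : Set ℓ₂} (P? : Dec P) (Q? : Dec Q) →
                  indicator (P? ×-dec Q?) ≡ indicator P? * indicator Q?
indicator-×-dec P? Q? with does P? | does Q?
... | true  | true  = refl
... | true  | false = refl
... | false | _     = refl

∑-const-1 : ∀ n → ∑[ i < n ] 1 ≡ n
∑-const-1 zero    = refl
∑-const-1 (suc n) = cong suc (∑-const-1 n)

∑[≡] : (c : Fin n) → ∑[ j < n ] [ j ≡ c ] ≡ 1
∑[≡] {suc n} zero    = cong suc (sum-replicate-zero n)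
∑[≡] {suc n} (suc c) = ∑[≡] c

∑[<] : (c : Fin n) → ∑[ j < n ] [ j < c ] ≡ toℕ c
∑[<] {suc n} zero    = sum-replicate-zero n
∑[<] {suc n} (suc c) = cong suc (∑[<] c)

∑[>] : (c : Fin n) → suc (toℕ c + ∑[ j < n ] [ c < j ]) ≡ n
∑[>] {suc n} zero    = cong suc (∑-const-1 n)
∑[>] {suc n} (suc c) = cong suc (∑[>] c)

∑² : (Fin n → Fin n → ℕ) → ℕ
∑² {n} H = ∑[ i < n ] ∑[ j < n ] H i j

∑²-cong : {H K : Fin n → Fin n → ℕ} → (∀ i j → H i j ≡ K i j) → ∑² H ≡ ∑² K
∑²-cong H≗K = sum-cong-≗ (λ i → sum-cong-≗ (H≗K i))

∑²-distrib-+ : (H K : Fin n → Fin n → ℕ) → ∑² (λ i j → H i j + K i j) ≡ ∑² H + ∑² K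
∑²-distrib-+ {n} H K = trans (sum-cong-≗ (λ i → ∑-distrib-+ (H i) (K i)))
  (∑-distrib-+ (λ i → ∑[ j < n ] H i j) (λ i → ∑[ j < n ] K i j))

∑[≡]* : (c : Fin n) (v : ℕ) → ∑[ j < n ] ([ j ≡ c ] * v) ≡ v
∑[≡]* {n} c v = begin
  ∑[ j < n ] ([ j ≡ c ] * v) ≡⟨ *-distribʳ-sum v (λ j → [ j ≡ c ]) ⟨
  ∑[ j < n ] [ j ≡ c ] * v   ≡⟨ cong (_* v) (∑[≡] c) ⟩
  1 * v                      ≡⟨ +-identityʳ v ⟩
  v                          ∎

∑²-row : (c : Fin n) (R : Fin n → ℕ) → ∑² (λ i j → [ i ≡ c ] * R j) ≡ ∑[ j < n ] R j
∑²-row c R = trans (sum-cong-≗ (λ i → sym (*-distribˡ-sum [ i ≡ c ] R))) (∑[≡]* c _)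

∑²-+row : (H : Fin n → Fin n → ℕ) (c : Fin n) (R : Fin n → ℕ) →
          ∑² (λ i j → H i j + [ i ≡ c ] * R j) ≡ ∑² H + ∑[ j < n ] R j
∑²-+row H c R = trans (∑²-distrib-+ H _) (cong (∑² H +_) (∑²-row c R))

∑²-+column : (H : Fin n → Fin n → ℕ) (c : Fin n) (C : Fin n → ℕ) →
             ∑² (λ i j → H i j + [ j ≡ c ] * C i) ≡ ∑² H + ∑[ i < n ] C i
∑²-+column H c C = trans (∑²-distrib-+ H _) (cong (∑² H +_) (sum-cong-≗ (λ i → ∑[≡]* c (C i))))

∑-mono-≤ : {F G : Fin n → ℕ} → (∀ i → F i ℕ.≤ G i) → ∑[ i < n ] F i ℕ.≤ ∑[ i < n ] G i
∑-mono-≤ {zero}  F≤G = z≤n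
∑-mono-≤ {suc n} F≤G = ℕ.+-mono-≤ (F≤G zero) (∑-mono-≤ (F≤G ∘ suc))

∑-mono-< : {F G : Fin n → ℕ} → (∀ i → F i ℕ.≤ G i) → (c : Fin n) → F c ℕ.< G c →
           ∑[ i < n ] F i ℕ.< ∑[ i < n ] G i
∑-mono-< F≤G zero    Fc<Gc = ℕ.+-mono-<-≤ Fc<Gc (∑-mono-≤ (F≤G ∘ suc))
∑-mono-< F≤G (suc c) Fc<Gc = ℕ.+-mono-≤-< (F≤G zero) (∑-mono-< (F≤G ∘ suc) c Fc<Gc)

-- Inversions as a double sum

length-filter-tabulate : {P : Pred A ℓ₂} (P? : Decidable P) (f : Fin n → A) →
                         length (filter P? (tabulate f)) ≡ ∑[ i < n ] indicator (P? (f i))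
length-filter-tabulate {n = zero}  P? f = refl
length-filter-tabulate {n = suc n} P? f with does (P? (f zero))
... | true  = cong suc (length-filter-tabulate P? (f ∘ suc))
... | false = length-filter-tabulate P? (f ∘ suc)

length-filter-cartesianProduct :
  {P : Pred (A × B) ℓ₂} (P? : Decidable P) (f : Fin n → A) (ys : List B) →
  length (filter P? (cartesianProduct (tabulate f) ys)) ≡
  ∑[ i < n ] length (filter P? (map (f i ,_) ys))
length-filter-cartesianProduct {n = zero}  P? f ys = refl
length-filter-cartesianProduct {n = suc n} P? f ys = begin
  length (filter P? (map (f zero ,_) ys ++ rest))
    ≡⟨ cong length (filter-++ P? (map (f zero ,_) ys) rest) ⟩
  length (filter P? (map (f zero ,_) ys) ++ filter P? rest)
    ≡⟨ length-++ (filter P? (map (f zero ,_) ys)) ⟩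
  length (filter P? (map (f zero ,_) ys)) + length (filter P? rest)
    ≡⟨ cong (length (filter P? (map (f zero ,_) ys)) +_) (length-filter-cartesianProduct P? (f ∘ suc) ys) ⟩
  ∑[ i < suc n ] length (filter P? (map (f i ,_) ys)) ∎
  where rest = cartesianProduct (tabulate (f ∘ suc)) ys

inversion : (Fin n → Fin n) → Fin n → Fin n → ℕ
inversion x i j = [ i < j ] * [ x j < x i ]

invF≡∑²inversion : (x : Fin n → Fin n) → invF x ≡ ∑² (inversion x)
invF≡∑²inversion {n} x = begin
  invF x
    ≡⟨ length-filter-cartesianProduct Inv? id (allFin n) ⟩
  ∑[ i < n ] length (filter Inv? (map (i ,_) (tabulate id)))
    ≡⟨ sum-cong-≗ (λ i → cong (length ∘ filter Inv?) (map-tabulate id (i ,_))) ⟩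
  ∑[ i < n ] length (filter Inv? (tabulate (i ,_)))
    ≡⟨ sum-cong-≗ (λ i → length-filter-tabulate Inv? (i ,_)) ⟩
  ∑² (λ i j → indicator (Inv? (i , j)))
    ≡⟨ ∑²-cong (λ i j → indicator-×-dec (i <? j) (x j <? x i)) ⟩
  ∑² (inversion x) ∎
  where Inv? = λ (ij : Fin n × Fin n) → let (i , j) = ij in (i <? j) ×-dec (x j <? x i)

-- The length of a transposition

record Transposed {A : Set ℓ₁} (a b : Fin n) (x y : Fin n → A) : Set ℓ₁ where
  field
    at-a      : y a ≡ x b
    at-b      : y b ≡ x a
    elsewhere : ∀ {k} → k ≢ a → k ≢ b → y k ≡ x k

open Transposed

module _ {a b : Fin n} where

  Transposed-sym : {x y : Fin n → A} → Transposed a b x y → Transposed a b y x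
  Transposed-sym T = record
    { at-a      = sym (at-b T)
    ; at-b      = sym (at-a T)
    ; elsewhere = λ k≢a k≢b → sym (elsewhere T k≢a k≢b)
    }

  Transposed-map : {x y : Fin n → A} (g : A → B) →
                   Transposed a b x y → Transposed a b (g ∘ x) (g ∘ y)
  Transposed-map g T = record
    { at-a      = cong g (at-a T)
    ; at-b      = cong g (at-b T)
    ; elsewhere = λ k≢a k≢b → cong g (elsewhere T k≢a k≢b)
    }

transpose-Transposed : (a b : Fin n) → Transposed a b id (PC.transpose a b)
transpose-Transposed a b = record { at-a = at-a′ ; at-b = at-b′ ; elsewhere = elsewhere′ }
  where
  at-a′ : PC.transpose a b a ≡ b
  at-a′ rewrite dec-true (a ≟ a) refl = refl

  at-b′ : PC.transpose a b b ≡ a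
  at-b′ with b ≟ a
  ... | yes b≡a = b≡a
  ... | no _ rewrite dec-true (b ≟ b) refl = refl

  elsewhere′ : ∀ {k} → k ≢ a → k ≢ b → PC.transpose a b k ≡ k
  elsewhere′ {k} k≢a k≢b rewrite dec-false (k ≟ a) k≢a | dec-false (k ≟ b) k≢b = refl

∘transpose⇒Transposed : {a b : Fin n} {x y : Fin n → A} →
                        (∀ i → y i ≡ x (PC.transpose a b i)) → Transposed a b x y
∘transpose⇒Transposed {a = a} {b} {x} y≗x∘t = record
  { at-a      = trans (y≗x∘t a) (cong x (at-a T))
  ; at-b      = trans (y≗x∘t b) (cong x (at-b T))
  ; elsewhere = λ k≢a k≢b → trans (y≗x∘t _) (cong x (elsewhere T k≢a k≢b))
  }
  where T = transpose-Transposed a b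

module _ {a b : Fin n} (a<b : a < b) {t : Fin n → Fin n} (T : Transposed a b id t) where

  inversion-transposition-≡0 : ∀ {i j} → i ≢ a → j ≢ b → inversion t i j ≡ 0
  inversion-transposition-≡0 {i} {j} i≢a j≢b with i ≟ b | j ≟ a
  ... | yes refl | yes refl rewrite [<]-no (<-asym a<b) = refl
  ... | yes refl | no j≢a rewrite at-b T | elsewhere T j≢a j≢b with <-cmp i j
  ...   | tri< b<j _ _ rewrite [<]-yes b<j | [<]-no (<-asym (<-trans a<b b<j)) = refl
  ...   | tri≈ _ b≡j _ = ⊥-elim (j≢b (sym b≡j))
  ...   | tri> b≮j _ _ rewrite [<]-no b≮j = refl
  inversion-transposition-≡0 {i} {j} i≢a j≢b | no i≢b | yes refl
    rewrite at-a T | elsewhere T i≢a i≢b with <-cmp i j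
  ...   | tri< i<a _ _ rewrite [<]-yes i<a | [<]-no (<-asym (<-trans i<a a<b)) = refl
  ...   | tri≈ _ i≡a _ = ⊥-elim (i≢a i≡a)
  ...   | tri> i≮a _ _ rewrite [<]-no i≮a = refl
  inversion-transposition-≡0 {i} {j} i≢a j≢b | no i≢b | no j≢a
    rewrite elsewhere T i≢a i≢b | elsewhere T j≢a j≢b = [<]*[>] i j

  -- The inversions of s_ab are (a, j) for a < j ≤ b and (i, b) for a < i < b.
  inversion-transposition : ∀ i j →
    inversion t i j + [ i ≡ a ] * [ b < j ] + [ j ≡ b ] * [ i < a ] + [ j ≡ b ] * [ i ≡ a ]
      ≡ [ i ≡ a ] * [ a < j ] + [ j ≡ b ] * [ i < b ]
  inversion-transposition i j with i ≟ a | j ≟ b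
  ... | yes refl | yes refl
    rewrite at-a T | at-b T | [<]-yes a<b | [<]-irrefl i | [<]-irrefl j = refl
  ... | yes refl | no j≢b with j ≟ a
  ...   | yes refl rewrite [<]-irrefl j | [<]-no (<-asym a<b) = refl
  ...   | no j≢a rewrite at-a T | elsewhere T j≢a j≢b with <-cmp j b
  ...     | tri< j<b _ _ rewrite [<]-yes j<b | [<]-no (<-asym j<b) with i <? j
  ...       | yes i<j rewrite [<]-yes i<j = refl
  ...       | no i≮j rewrite [<]-no i≮j = refl
  inversion-transposition i j | yes refl | no j≢b | no j≢a | tri≈ _ j≡b _ = ⊥-elim (j≢b j≡b)
  inversion-transposition i j | yes refl | no j≢b | no j≢a | tri> _ _ b<j
    rewrite [<]-no (<-asym b<j) | [<]-yes b<j | [<]-yes (<-trans a<b b<j) = refl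
  inversion-transposition i j | no i≢a | yes refl with i ≟ b
  ... | yes refl rewrite [<]-irrefl i | [<]-no (<-asym a<b) = refl
  ... | no i≢b rewrite at-b T | elsewhere T i≢a i≢b with <-cmp i a
  ...   | tri< i<a _ _ rewrite [<]-yes i<a | [<]-no (<-asym i<a) | [<]-yes (<-trans i<a a<b) = refl
  ...   | tri≈ _ i≡a _ = ⊥-elim (i≢a i≡a)
  ...   | tri> i≮a _ a<i rewrite [<]-no i≮a | [<]-yes a<i with i <? j
  ...     | yes i<j rewrite [<]-yes i<j = refl
  ...     | no i≮j rewrite [<]-no i≮j = refl
  inversion-transposition i j | no i≢a | no j≢b rewrite inversion-transposition-≡0 i≢a j≢b = refl

  ∑²-inversion-transposition :
    invF t + ∑[ j < n ] [ b < j ] + toℕ a + 1 ≡ ∑[ j < n ] [ a < j ] + toℕ b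
  ∑²-inversion-transposition = begin
    invF t + above-b + toℕ a + 1
      ≡⟨ cong₂ (λ ℓt α → ℓt + above-b + α + 1) (invF≡∑²inversion t) (sym (∑[<] a)) ⟩
    ∑² I + above-b + ∑[ i < n ] [ i < a ] + 1
      ≡⟨ cong (∑² I + above-b + ∑[ i < n ] [ i < a ] +_) (∑[≡] a) ⟨
    ∑² I + above-b + ∑[ i < n ] [ i < a ] + ∑[ i < n ] [ i ≡ a ]
      ≡⟨ cong (λ S → S + ∑[ i < n ] [ i < a ] + ∑[ i < n ] [ i ≡ a ]) (∑²-+row I a (λ j → [ b < j ])) ⟨
    ∑² (λ i j → I i j + [ i ≡ a ] * [ b < j ]) + ∑[ i < n ] [ i < a ] + ∑[ i < n ] [ i ≡ a ]
      ≡⟨ cong (_+ ∑[ i < n ] [ i ≡ a ]) (∑²-+column _ b (λ i → [ i < a ])) ⟨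
    ∑² (λ i j → I i j + [ i ≡ a ] * [ b < j ] + [ j ≡ b ] * [ i < a ]) + ∑[ i < n ] [ i ≡ a ]
      ≡⟨ ∑²-+column _ b (λ i → [ i ≡ a ]) ⟨
    ∑² (λ i j → I i j + [ i ≡ a ] * [ b < j ] + [ j ≡ b ] * [ i < a ] + [ j ≡ b ] * [ i ≡ a ])
      ≡⟨ ∑²-cong inversion-transposition ⟩
    ∑² (λ i j → [ i ≡ a ] * [ a < j ] + [ j ≡ b ] * [ i < b ])
      ≡⟨ ∑²-+column _ b (λ i → [ i < b ]) ⟩
    ∑² (λ i j → [ i ≡ a ] * [ a < j ]) + ∑[ i < n ] [ i < b ]
      ≡⟨ cong₂ _+_ (∑²-row a (λ j → [ a < j ])) (∑[<] b) ⟩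
    ∑[ j < n ] [ a < j ] + toℕ b ∎
    where
    I = inversion t
    above-b = ∑[ j < n ] [ b < j ]

transposition-arithmetic : ∀ {L α β Na Nb n} → L + Nb + α + 1 ≡ Na + β →
                           suc (α + Na) ≡ n → suc (β + Nb) ≡ n → L + suc (2 * α) ≡ 2 * β
transposition-arithmetic {L} {α} {β} {Na} {Nb} sums hα hβ = +-cancelʳ-≡ (suc Nb) _ _ (begin
  L + suc (2 * α) + suc Nb ≡⟨ solve (L ∷ α ∷ Nb ∷ []) ⟩
  L + Nb + α + 1 + suc α   ≡⟨ cong (_+ suc α) sums ⟩
  Na + β + suc α           ≡⟨ solve (Na ∷ α ∷ β ∷ []) ⟩
  suc (α + Na) + β         ≡⟨ cong (_+ β) (trans hα (sym hβ)) ⟩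
  suc (β + Nb) + β         ≡⟨ solve (β ∷ Nb ∷ []) ⟩
  2 * β + suc Nb           ∎)

invF-transpose : {a b : Fin n} → a < b → invF (PC.transpose a b) + suc (2 * toℕ a) ≡ 2 * toℕ b
invF-transpose {a = a} {b} a<b = transposition-arithmetic
  (∑²-inversion-transposition a<b (transpose-Transposed a b)) (∑[>] a) (∑[>] b)

-- The rotation o

oF-injective : {m : ℕ} {x y : Fin (suc m)} → oF x ≡ oF y → x ≡ y
oF-injective {x = x} {y} oFx≡oFy = trans (sym (oI-oF x)) (trans (cong oI oFx≡oFy) (oI-oF y))

toℕ-oF : {m : ℕ} {x : Fin (suc m)} → x ≢ fromℕ m → toℕ (oF x) ≡ suc (toℕ x)
toℕ-oF {zero}  {zero} x≢max = ⊥-elim (x≢max refl)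
toℕ-oF {suc m} {x}    x≢max = begin
  toℕ (oF x)            ≡⟨ cong (toℕ ∘ oF) (inject₁-lower₁ x m+1≢x) ⟨
  toℕ (oF (inject₁ x′)) ≡⟨ cong toℕ (oF-inject x′) ⟩
  suc (toℕ x′)          ≡⟨ cong suc (toℕ-lower₁ x m+1≢x) ⟩
  suc (toℕ x)           ∎
  where
  m+1≢x : suc m ≢ toℕ x
  m+1≢x m+1≡x = x≢max (toℕ-injective (trans (sym m+1≡x) (sym (toℕ-fromℕ (suc m)))))
  x′ = lower₁ x m+1≢x

module _ {m : ℕ} {x : Fin (suc m)} (x≢max : x ≢ fromℕ m) where

  <max : x < fromℕ m
  <max = ℕ.≤∧≢⇒< (≤fromℕ x) (x≢max ∘ toℕ-injective)

  zero<oF : zero {m} < oF x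
  zero<oF = subst (0 ℕ.<_) (sym (toℕ-oF x≢max)) (s≤s z≤n)

  [<max] : [ x < fromℕ m ] ≡ 1
  [<max] = [<]-yes <max

  [max<] : [ fromℕ m < x ] ≡ 0
  [max<] = [<]-no (ℕ.≤⇒≯ (≤fromℕ x))

  [zero<oF] : [ zero < oF x ] ≡ 1
  [zero<oF] = [<]-yes zero<oF

  -- [ i < j ] computes as the test toℕ i ℕ.<ᵇ toℕ j, and oF adds one to both sides.
  [oF<oF] : {y : Fin (suc m)} → y ≢ fromℕ m → [ oF x < oF y ] ≡ [ x < y ]
  [oF<oF] y≢max = cong₂ (λ k l → if k ℕ.<ᵇ l then 1 else 0) (toℕ-oF x≢max) (toℕ-oF y≢max)

module _ {m : ℕ} {f : Fin (suc m) → Fin (suc m)} (f-injective : ∀ {i j} → f i ≡ f j → i ≡ j)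
         {p : Fin (suc m)} (fp≡max : f p ≡ fromℕ m) where

  private
    f≢max : ∀ {i} → i ≢ p → f i ≢ fromℕ m
    f≢max i≢p fi≡max = i≢p (f-injective (trans fi≡max (sym fp≡max)))

  inversion-rotation : ∀ i j →
    inversion (oF ∘ f) i j + [ i ≡ p ] * [ p < j ] ≡ inversion f i j + [ j ≡ p ] * [ i < p ]
  inversion-rotation i j with i ≟ p | j ≟ p
  ... | yes refl | yes refl rewrite [<]-irrefl i = refl
  ... | yes refl | no j≢p rewrite fp≡max | oF-fromℕ m | [<max] (f≢max j≢p) with i <? j
  ...   | yes i<j rewrite [<]-yes i<j = refl
  ...   | no i≮j rewrite [<]-no i≮j = refl
  inversion-rotation i j | no i≢p | yes refl
    rewrite fp≡max | oF-fromℕ m | [zero<oF] (f≢max i≢p) | [max<] (f≢max i≢p) with i <? j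
  ...   | yes i<j rewrite [<]-yes i<j = refl
  ...   | no i≮j rewrite [<]-no i≮j = refl
  inversion-rotation i j | no i≢p | no j≢p rewrite [oF<oF] (f≢max j≢p) (f≢max i≢p) = refl

  ∑²-inversion-rotation : invF (oF ∘ f) + ∑[ j < suc m ] [ p < j ] ≡ invF f + toℕ p
  ∑²-inversion-rotation = begin
    invF (oF ∘ f) + ∑[ j < suc m ] [ p < j ]
      ≡⟨ cong (_+ ∑[ j < suc m ] [ p < j ]) (invF≡∑²inversion (oF ∘ f)) ⟩
    ∑² (inversion (oF ∘ f)) + ∑[ j < suc m ] [ p < j ]
      ≡⟨ ∑²-+row (inversion (oF ∘ f)) p (λ j → [ p < j ]) ⟨
    ∑² (λ i j → inversion (oF ∘ f) i j + [ i ≡ p ] * [ p < j ])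
      ≡⟨ ∑²-cong inversion-rotation ⟩
    ∑² (λ i j → inversion f i j + [ j ≡ p ] * [ i < p ])
      ≡⟨ ∑²-+column (inversion f) p (λ i → [ i < p ]) ⟩
    ∑² (inversion f) + ∑[ i < suc m ] [ i < p ]
      ≡⟨ cong₂ _+_ (sym (invF≡∑²inversion f)) (∑[<] p) ⟩
    invF f + toℕ p ∎

rotation-arithmetic : ∀ {X Y α Na n} → X + Na ≡ Y + α → suc (α + Na) ≡ n → X + n ≡ Y + suc (2 * α)
rotation-arithmetic {X} {Y} {α} {Na} {n} sums hα = begin
  X + n               ≡⟨ cong (X +_) hα ⟨
  X + suc (α + Na)    ≡⟨ solve (X ∷ α ∷ Na ∷ []) ⟩
  X + Na + suc α      ≡⟨ cong (_+ suc α) sums ⟩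
  Y + α + suc α       ≡⟨ solve (Y ∷ α ∷ []) ⟩
  Y + suc (2 * α)     ∎

invF-rotation : {m : ℕ} {f : Fin (suc m) → Fin (suc m)} → (∀ {i j} → f i ≡ f j → i ≡ j) →
                {p : Fin (suc m)} → f p ≡ fromℕ m → invF (oF ∘ f) + suc m ≡ invF f + suc (2 * toℕ p)
invF-rotation f-injective {p} fp≡max =
  rotation-arithmetic (∑²-inversion-rotation f-injective fp≡max) (∑[>] p)

⟨$⟩ʳ-injective : (π : Permutation′ n) {i j : Fin n} → π ⟨$⟩ʳ i ≡ π ⟨$⟩ʳ j → i ≡ j
⟨$⟩ʳ-injective π = Injection.injective (↔⇒↣ π)

ℓ-o· : {m : ℕ} (π : Permutation′ (suc m)) {p : Fin (suc m)} → π ⟨$⟩ʳ p ≡ fromℕ m →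
       ℓ (o· π) + suc m ≡ ℓ π + suc (2 * toℕ p)
ℓ-o· π = invF-rotation (⟨$⟩ʳ-injective π)

-- Transposing an ascent increases the length

-- Merging row b into row a and column b into column a puts the pairs (a, k), (b, k) and
-- (k, a), (k, b) side by side; at an ascent the merged inversion counts compare pointwise.
module _ {a b : Fin n} where

  merge : (Fin n → ℕ) → Fin n → ℕ
  merge F k with k ≟ a | k ≟ b
  ... | yes _ | _     = F a + F b
  ... | no _  | yes _ = 0
  ... | no _  | no _  = F k

  merge-a : (F : Fin n → ℕ) → merge F a ≡ F a + F b
  merge-a F with a ≟ a
  ... | yes _   = refl
  ... | no a≢a = ⊥-elim (a≢a refl)

  merge-∑ : (H : Fin n → Fin n → ℕ) (k : Fin n) →
            merge (λ i → ∑[ j < n ] H i j) k ≡ ∑[ j < n ] merge (λ i → H i j) k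
  merge-∑ H k with k ≟ a | k ≟ b
  ... | yes _ | _     = sym (∑-distrib-+ (H a) (H b))
  ... | no _  | yes _ = sym (sum-replicate-zero n)
  ... | no _  | no _  = refl

  merge² : (Fin n → Fin n → ℕ) → Fin n → Fin n → ℕ
  merge² H i j = merge (λ i′ → merge (H i′) j) i

  module _ (a≢b : a ≢ b) where

    ∑-merge : (F : Fin n → ℕ) → ∑[ k < n ] merge F k ≡ ∑[ k < n ] F k
    ∑-merge F = +-cancelʳ-≡ (F b) _ _ (begin
      ∑[ k < n ] merge F k + F b
        ≡⟨ cong (∑[ k < n ] merge F k +_) (∑[≡]* b (F b)) ⟨
      ∑[ k < n ] merge F k + ∑[ k < n ] ([ k ≡ b ] * F b)
        ≡⟨ ∑-distrib-+ (merge F) _ ⟨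
      ∑[ k < n ] (merge F k + [ k ≡ b ] * F b)
        ≡⟨ sum-cong-≗ moved ⟩
      ∑[ k < n ] (F k + [ k ≡ a ] * F b)
        ≡⟨ ∑-distrib-+ F _ ⟩
      ∑[ k < n ] F k + ∑[ k < n ] ([ k ≡ a ] * F b)
        ≡⟨ cong (∑[ k < n ] F k +_) (∑[≡]* a (F b)) ⟩
      ∑[ k < n ] F k + F b ∎)
      where
      moved : ∀ k → merge F k + [ k ≡ b ] * F b ≡ F k + [ k ≡ a ] * F b
      moved k with k ≟ a | k ≟ b
      ... | yes refl | yes refl = ⊥-elim (a≢b refl)
      ... | yes refl | no _     = ℕ.+-assoc (F k) (F b) 0
      ... | no _     | yes refl = refl
      ... | no _     | no _     = refl

    ∑²-merge² : (H : Fin n → Fin n → ℕ) → ∑² (merge² H) ≡ ∑² H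
    ∑²-merge² H = begin
      ∑² (merge² H)
        ≡⟨ sum-cong-≗ (merge-∑ (λ i′ j → merge (H i′) j)) ⟨
      ∑[ i < n ] merge (λ i′ → ∑[ j < n ] merge (H i′) j) i
        ≡⟨ ∑-merge _ ⟩
      ∑[ i < n ] ∑[ j < n ] merge (H i) j
        ≡⟨ sum-cong-≗ (λ i → ∑-merge (H i)) ⟩
      ∑² H ∎

    module _ {H K : Fin n → Fin n → ℕ}
      (corner : H a a + H a b + (H b a + H b b) ℕ.< K a a + K a b + (K b a + K b b))
      (row    : ∀ {k} → k ≢ a → k ≢ b → H a k + H b k ℕ.≤ K a k + K b k)
      (column : ∀ {k} → k ≢ a → k ≢ b → H k a + H k b ℕ.≤ K k a + K k b)
      (rest   : ∀ {k l} → k ≢ a → k ≢ b → l ≢ a → l ≢ b → H k l ℕ.≤ K k l) where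

      merge²-mono : ∀ i j → merge² H i j ℕ.≤ merge² K i j
      merge²-mono i j with i ≟ a | i ≟ b | j ≟ a | j ≟ b
      ... | yes refl | _        | yes refl | _        = ℕ.<⇒≤ corner
      ... | yes refl | _        | no _     | yes _    = z≤n
      ... | yes refl | _        | no j≢a   | no j≢b   = row j≢a j≢b
      ... | no _     | yes _    | _        | _        = z≤n
      ... | no i≢a   | no i≢b   | yes refl | _        = column i≢a i≢b
      ... | no _     | no _     | no _     | yes _    = z≤n
      ... | no i≢a   | no i≢b   | no j≢a   | no j≢b   = rest i≢a i≢b j≢a j≢b

      merge²-corner : merge² H a a ℕ.< merge² K a a
      merge²-corner rewrite merge-a (λ i′ → merge (H i′) a) | merge-a (λ i′ → merge (K i′) a)
                          | merge-a (H a) | merge-a (H b) | merge-a (K a) | merge-a (K b) = corner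

      ∑²-mono-< : ∑² H ℕ.< ∑² K
      ∑²-mono-< = subst₂ ℕ._<_ (∑²-merge² H) (∑²-merge² K)
        (∑-mono-< (λ i → ∑-mono-≤ (merge²-mono i)) a (∑-mono-< (merge²-mono a) a merge²-corner))

module _ {a b : Fin n} (a<b : a < b) {x y : Fin n → Fin n} (xa<xb : x a < x b) (T : Transposed a b x y) where

  private
    corner : inversion x a a + inversion x a b + (inversion x b a + inversion x b b) ℕ.<
             inversion y a a + inversion y a b + (inversion y b a + inversion y b b)
    corner rewrite at-a T | at-b T | [<]-irrefl a | [<]-irrefl b | [<]-yes a<b | [<]-no (<-asym a<b)
                 | [<]-yes xa<xb | [<]-no (<-asym xa<xb) = ℕ.n<1+n 0

    row : ∀ {k} → k ≢ a → k ≢ b →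
          inversion x a k + inversion x b k ℕ.≤ inversion y a k + inversion y b k
    row {k} k≢a k≢b rewrite at-a T | at-b T | elsewhere T k≢a k≢b with <-cmp k a
    ... | tri< k<a _ _ rewrite [<]-no (<-asym k<a) | [<]-no (<-asym (<-trans k<a a<b)) = z≤n
    ... | tri≈ _ k≡a _ = ⊥-elim (k≢a k≡a)
    ... | tri> _ _ a<k rewrite [<]-yes a<k with <-cmp k b
    ...   | tri≈ _ k≡b _ = ⊥-elim (k≢b k≡b)
    ...   | tri> _ _ b<k rewrite [<]-yes b<k =
      ℕ.≤-reflexive (ℕ.+-comm (1 * [ x k < x a ]) (1 * [ x k < x b ]))
    ...   | tri< k<b _ _ rewrite [<]-no (<-asym k<b) with x k <? x a
    ...     | yes xk<xa rewrite [<]-yes xk<xa | [<]-yes (<-trans xk<xa xa<xb) = ℕ.≤-refl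
    ...     | no xk≮xa rewrite [<]-no xk≮xa = z≤n

    column : ∀ {k} → k ≢ a → k ≢ b →
             inversion x k a + inversion x k b ℕ.≤ inversion y k a + inversion y k b
    column {k} k≢a k≢b rewrite at-a T | at-b T | elsewhere T k≢a k≢b with <-cmp k b
    ... | tri> _ _ b<k rewrite [<]-no (<-asym b<k) | [<]-no (<-asym (<-trans a<b b<k)) = z≤n
    ... | tri≈ _ k≡b _ = ⊥-elim (k≢b k≡b)
    ... | tri< k<b _ _ rewrite [<]-yes k<b with <-cmp k a
    ...   | tri≈ _ k≡a _ = ⊥-elim (k≢a k≡a)
    ...   | tri< k<a _ _ rewrite [<]-yes k<a =
      ℕ.≤-reflexive (ℕ.+-comm (1 * [ x a < x k ]) (1 * [ x b < x k ]))
    ...   | tri> _ _ a<k rewrite [<]-no (<-asym a<k) with x b <? x k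
    ...     | yes xb<xk rewrite [<]-yes xb<xk | [<]-yes (<-trans xa<xb xb<xk) = ℕ.≤-refl
    ...     | no xb≮xk rewrite [<]-no xb≮xk = z≤n

    rest : ∀ {k l} → k ≢ a → k ≢ b → l ≢ a → l ≢ b → inversion x k l ℕ.≤ inversion y k l
    rest k≢a k≢b l≢a l≢b rewrite elsewhere T k≢a k≢b | elsewhere T l≢a l≢b = ℕ.≤-refl

  invF-ascent : invF x ℕ.< invF y
  invF-ascent = subst₂ ℕ._<_ (sym (invF≡∑²inversion x)) (sym (invF≡∑²inversion y))
    (∑²-mono-< (<⇒≢ a<b) corner row column rest)

-- The edge relation under the rotation

-- LengthStep (ℓ (s a b)) (ℓ u) (ℓ w) is the length condition of Edge u w.
LengthStep : ℕ → ℕ → ℕ → Set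
LengthStep L x y = y ≡ suc x ⊎ y + L ≡ x

module _ {L x y : ℕ} where

  LengthStep-ascent : x ℕ.< y → LengthStep L x y → y ≡ suc x
  LengthStep-ascent x<y (inj₁ y≡1+x)  = y≡1+x
  LengthStep-ascent x<y (inj₂ y+L≡x) = ⊥-elim (ℕ.<⇒≱ x<y (subst (y ℕ.≤_) y+L≡x (ℕ.m≤m+n y L)))

  LengthStep-descent : y ℕ.< x → LengthStep L x y → y + L ≡ x
  LengthStep-descent y<x (inj₁ y≡1+x)  = ⊥-elim (ℕ.<-asym y<x (subst (x ℕ.<_) (sym y≡1+x) (ℕ.n<1+n x)))
  LengthStep-descent y<x (inj₂ y+L≡x) = y+L≡x

  LengthStep-shift : ∀ {x′ y′ k c} → x′ + k ≡ x + c → y′ + k ≡ y + c →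
                     LengthStep L x y → LengthStep L x′ y′
  LengthStep-shift {x′} {y′} {k} {c} hx hy (inj₁ y≡1+x) = inj₁ (+-cancelʳ-≡ k y′ (suc x′) (begin
    y′ + k      ≡⟨ hy ⟩
    y + c       ≡⟨ cong (_+ c) y≡1+x ⟩
    suc x + c   ≡⟨ cong suc hx ⟨
    suc x′ + k  ∎))
  LengthStep-shift {x′} {y′} {k} {c} hx hy (inj₂ y+L≡x) = inj₂ (+-cancelʳ-≡ k (y′ + L) x′ (begin
    y′ + L + k  ≡⟨ solve (y′ ∷ L ∷ k ∷ []) ⟩
    y′ + k + L  ≡⟨ cong (_+ L) hy ⟩
    y + c + L   ≡⟨ solve (y ∷ c ∷ L ∷ []) ⟩
    y + L + c   ≡⟨ cong (_+ c) y+L≡x ⟩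
    x + c       ≡⟨ hx ⟨
    x′ + k      ∎))

module _ {x y x′ y′ α β L n : ℕ} (hL : L + suc (2 * α) ≡ 2 * β) where

  max-at-b-arithmetic : x′ + n ≡ x + suc (2 * β) → y′ + n ≡ y + suc (2 * α) → y ≡ suc x ⇔ y′ + L ≡ x′
  max-at-b-arithmetic hx hy = mk⇔
    (λ y≡1+x → +-cancelʳ-≡ n (y′ + L) x′ (begin
      y′ + L + n                ≡⟨ solve (y′ ∷ L ∷ n ∷ []) ⟩
      y′ + n + L                ≡⟨ cong (_+ L) hy ⟩
      y + suc (2 * α) + L       ≡⟨ cong (λ z → z + suc (2 * α) + L) y≡1+x ⟩
      suc x + suc (2 * α) + L   ≡⟨ solve (x ∷ α ∷ L ∷ []) ⟩
      suc x + (L + suc (2 * α)) ≡⟨ cong (suc x +_) hL ⟩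
      suc x + 2 * β             ≡⟨ solve (x ∷ β ∷ []) ⟩
      x + suc (2 * β)           ≡⟨ hx ⟨
      x′ + n                    ∎))
    (λ y′+L≡x′ → +-cancelʳ-≡ (L + suc (2 * α)) y (suc x) (begin
      y + (L + suc (2 * α))     ≡⟨ solve (y ∷ L ∷ α ∷ []) ⟩
      y + suc (2 * α) + L       ≡⟨ cong (_+ L) hy ⟨
      y′ + n + L                ≡⟨ solve (y′ ∷ n ∷ L ∷ []) ⟩
      y′ + L + n                ≡⟨ cong (_+ n) y′+L≡x′ ⟩
      x′ + n                    ≡⟨ hx ⟩
      x + suc (2 * β)           ≡⟨ solve (x ∷ β ∷ []) ⟩
      suc x + 2 * β             ≡⟨ cong (suc x +_) hL ⟨
      suc x + (L + suc (2 * α)) ∎))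

  max-at-a-arithmetic : x′ + n ≡ x + suc (2 * α) → y′ + n ≡ y + suc (2 * β) → y + L ≡ x ⇔ y′ ≡ suc x′
  max-at-a-arithmetic hx hy = mk⇔
    (λ y+L≡x → +-cancelʳ-≡ n y′ (suc x′) (begin
      y′ + n                      ≡⟨ hy ⟩
      y + suc (2 * β)             ≡⟨ cong (λ z → y + suc z) hL ⟨
      y + suc (L + suc (2 * α))   ≡⟨ solve (y ∷ L ∷ α ∷ []) ⟩
      suc (y + L + suc (2 * α))   ≡⟨ cong (λ z → suc (z + suc (2 * α))) y+L≡x ⟩
      suc (x + suc (2 * α))       ≡⟨ cong suc hx ⟨
      suc (x′ + n)                ∎))
    (λ y′≡1+x′ → +-cancelʳ-≡ (suc (2 * α)) (y + L) x (ℕ.suc-injective (begin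
      suc (y + L + suc (2 * α))   ≡⟨ solve (y ∷ L ∷ α ∷ []) ⟩
      y + suc (L + suc (2 * α))   ≡⟨ cong (λ z → y + suc z) hL ⟩
      y + suc (2 * β)             ≡⟨ hy ⟨
      y′ + n                      ≡⟨ cong (_+ n) y′≡1+x′ ⟩
      suc (x′ + n)                ≡⟨ cong suc hx ⟩
      suc (x + suc (2 * α))       ∎)))

module _ {m : ℕ} (u w : Permutation′ (suc m)) {a b : Fin (suc m)} (a<b : a < b)
         (T : Transposed a b (u ⟨$⟩ʳ_) (w ⟨$⟩ʳ_)) where

  private
    LengthSteps⇔ : Set
    LengthSteps⇔ = LengthStep (ℓ (s a b)) (ℓ u) (ℓ w) ⇔ LengthStep (ℓ (s a b)) (ℓ (o· u)) (ℓ (o· w))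

    ℓs : ℓ (s a b) + suc (2 * toℕ a) ≡ 2 * toℕ b
    ℓs = invF-transpose a<b

    oT : Transposed a b (oF ∘ (u ⟨$⟩ʳ_)) (oF ∘ (w ⟨$⟩ʳ_))
    oT = Transposed-map oF T

    oF-max : {x : Fin (suc m)} → x ≡ fromℕ m → oF x ≡ zero
    oF-max x≡max = trans (cong oF x≡max) (oF-fromℕ _)

  LengthStep-o·-max-elsewhere : ∀ {p} → p ≢ a → p ≢ b → u ⟨$⟩ʳ p ≡ fromℕ m → LengthSteps⇔
  LengthStep-o·-max-elsewhere p≢a p≢b up = mk⇔
    (LengthStep-shift (ℓ-o· u up) (ℓ-o· w wp))
    (LengthStep-shift (sym (ℓ-o· u up)) (sym (ℓ-o· w wp)))
    where wp = trans (elsewhere T p≢a p≢b) up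

  LengthStep-o·-max-at-b : u ⟨$⟩ʳ b ≡ fromℕ m → LengthSteps⇔
  LengthStep-o·-max-at-b ub = mk⇔
    (λ step → inj₂ (Equivalence.to lengths (LengthStep-ascent ℓu<ℓw step)))
    (λ step → inj₁ (Equivalence.from lengths (LengthStep-descent ℓow<ℓou step)))
    where
    wa = trans (at-a T) ub
    ua≢max : u ⟨$⟩ʳ a ≢ fromℕ m
    ua≢max ua≡max = <⇒≢ a<b (⟨$⟩ʳ-injective u (trans ua≡max (sym ub)))
    ℓu<ℓw = invF-ascent a<b (subst (u ⟨$⟩ʳ a <_) (sym ub) (<max ua≢max)) T
    ℓow<ℓou = invF-ascent a<b
      (subst₂ _<_ (sym (oF-max wa)) (cong oF (sym (at-b T))) (zero<oF ua≢max)) (Transposed-sym oT)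
    lengths = max-at-b-arithmetic {α = toℕ a} {toℕ b} ℓs (ℓ-o· u ub) (ℓ-o· w wa)

  LengthStep-o·-max-at-a : u ⟨$⟩ʳ a ≡ fromℕ m → LengthSteps⇔
  LengthStep-o·-max-at-a ua = mk⇔
    (λ step → inj₁ (Equivalence.to lengths (LengthStep-descent ℓw<ℓu step)))
    (λ step → inj₂ (Equivalence.from lengths (LengthStep-ascent ℓou<ℓow step)))
    where
    wb = trans (at-b T) ua
    ub≢max : u ⟨$⟩ʳ b ≢ fromℕ m
    ub≢max ub≡max = <⇒≢ a<b (⟨$⟩ʳ-injective u (trans ua (sym ub≡max)))
    ℓw<ℓu = invF-ascent a<b (subst₂ _<_ (sym (at-a T)) (sym wb) (<max ub≢max)) (Transposed-sym T)
    ℓou<ℓow = invF-ascent a<b (subst (_< oF (u ⟨$⟩ʳ b)) (sym (oF-max ua)) (zero<oF ub≢max)) oT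
    lengths = max-at-a-arithmetic {α = toℕ a} {toℕ b} ℓs (ℓ-o· u ua) (ℓ-o· w wb)

  LengthStep-o· : LengthStep (ℓ (s a b)) (ℓ u) (ℓ w) ⇔ LengthStep (ℓ (s a b)) (ℓ (o· u)) (ℓ (o· w))
  LengthStep-o· = by-position-of-max (u ⟨$⟩ˡ fromℕ m) (inverseʳ u)
    where
    by-position-of-max : ∀ p → u ⟨$⟩ʳ p ≡ fromℕ m → LengthSteps⇔
    by-position-of-max p up with p ≟ a | p ≟ b
    ... | yes refl | _        = LengthStep-o·-max-at-a up
    ... | no _     | yes refl = LengthStep-o·-max-at-b up
    ... | no p≢a   | no p≢b   = LengthStep-o·-max-elsewhere p≢a p≢b up

corollary5p1 : (n : ℕ) (u w : Permutation′ n) → Edge u w ⇔ Edge (o· u) (o· w)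
corollary5p1 zero    u w = mk⇔ (λ { (() , _) }) (λ { (() , _) })
corollary5p1 (suc m) u w = mk⇔
  (λ (a , b , a<b , w≗u∘s , step) →
     a , b , a<b , (λ i → cong oF (w≗u∘s i)) ,
     Equivalence.to (LengthStep-o· u w a<b (∘transpose⇒Transposed w≗u∘s)) step)
  (λ (a , b , a<b , ow≗ou∘s , step) →
     let w≗u∘s = λ i → oF-injective (ow≗ou∘s i)
     in a , b , a<b , w≗u∘s ,
        Equivalence.from (LengthStep-o· u w a<b (∘transpose⇒Transposed w≗u∘s)) step)
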